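{- For any two graphs $G$ and $H$, the independent domination polynomial of the lexicographic product $G[H]$ satisfies $D_i(G[H],x)=D_i\big(G,D_i(H,x)\big)$.
   Context: All graphs are finite and simple. A set $S\subseteq V(G)$ is an independent dominating set of $G$ if no two vertices of $S$ are adjacent and every vertex of $V(G)\setminus S$ has a neighbour in $S$. Let $d_i(G,k)$ be the number of independent dominating sets of $G$ of cardinality $k$, and $D_i(G,x)=\sum_{k} d_i(G,k)x^k$. The lexicographic product $G[H]$ has vertex set $V(G)\times V(H)$, with $(a,x)$ adjacent to $(b,y)$ if and only if $a$ is adjacent to $b$ in $G$, or $a=b$ and $x$ is adjacent to $y$ in $H$. -}

module Defs where

open import Data.Bool using (Bool; true; false; T; _∨_; _∧_)
open import Data.Nat using (ℕ; zero; suc; _+_; _*_; _≟_)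
open import Data.Fin using (Fin; remQuot)
open import Data.Fin.Properties using (all?; any?)
open import Data.Fin.Subset using (Subset; _∈_; _∉_; ∣_∣)
open import Data.Fin.Subset.Properties using (_∈?_)
open import Data.Vec using (Vec; []; _∷_)
open import Data.List using (List; []; _∷_; map; _++_; length; filter; upTo)
open import Data.Product using (_×_; _,_; ∃)
open import Relation.Nullary using (¬_; Dec; yes; no; ¬?)
open import Relation.Nullary.Decidable using (_×-dec_; _→-dec_)
open import Relation.Binary.PropositionalEquality using (_≡_)

record Graph (n : ℕ) : Set where
  constructor graph
  field adj : Fin n → Fin n → Bool
open Graph public

Adj : ∀ {n} → Graph n → Fin n → Fin n → Set
Adj G u v = T (adj G u v)

record IsSimple {n : ℕ} (G : Graph n) : Set where
  field
    irrefl : ∀ u → ¬ Adj G u u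
    sym    : ∀ u v → Adj G u v → Adj G v u

-- Lexicographic product G[H] on Fin (m * n) ≅ Fin m × Fin n
-- (via the standard bijection remQuot):
-- (a,x) ~ (b,y)  iff  a ~ b in G, or a = b and x ~ y in H.

lexProd : ∀ {m n} → Graph m → Graph n → Graph (m * n)
lexProd {m} {n} G H = graph λ p q → go (remQuot n p) (remQuot n q)
  where
  import Data.Fin as F
  open import Relation.Nullary.Decidable using (does)
  go : Fin m × Fin n → Fin m × Fin n → Bool
  go (a , x) (b , y) = adj G a b ∨ (does (a F.≟ b) ∧ adj H x y)

IsIndependent : ∀ {n} → Graph n → Subset n → Set
IsIndependent G S = ∀ u v → u ∈ S → v ∈ S → ¬ Adj G u v

IsDominating : ∀ {n} → Graph n → Subset n → Set
IsDominating G S = ∀ v → v ∉ S → ∃ λ u → u ∈ S × Adj G u v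

IsIndepDom : ∀ {n} → Graph n → Subset n → Set
IsIndepDom G S = IsIndependent G S × IsDominating G S

T? : ∀ b → Dec (T b)
T? true  = yes _
T? false = no λ ()

isIndepDom? : ∀ {n} (G : Graph n) (S : Subset n) → Dec (IsIndepDom G S)
isIndepDom? G S =
  all? (λ u → all? (λ v → (u ∈? S) →-dec ((v ∈? S) →-dec ¬? (T? (adj G u v)))))
  ×-dec all? (λ v → ¬? (v ∈? S) →-dec any? (λ u → (u ∈? S) ×-dec T? (adj G u v)))

allSubsets : ∀ n → List (Subset n)
allSubsets zero    = [] ∷ []
allSubsets (suc n) = map (true ∷_) (allSubsets n) ++ map (false ∷_) (allSubsets n)

di : ∀ {n} → Graph n → ℕ → ℕ
di {n} G k = length (filter (λ S → isIndepDom? G S ×-dec (∣ S ∣ ≟ k)) (allSubsets n))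

-- Polynomials with natural-number coefficients, as coefficient lists
-- (constant term first).

Poly : Set
Poly = List ℕ

coeff : Poly → ℕ → ℕ
coeff []       _       = 0
coeff (a ∷ _)  zero    = a
coeff (_ ∷ as) (suc k) = coeff as k

infixl 6 _+P_
infixl 7 _*P_

_+P_ : Poly → Poly → Poly
[]       +P q        = q
p        +P []       = p
(a ∷ as) +P (b ∷ bs) = (a + b) ∷ (as +P bs)

scale : ℕ → Poly → Poly
scale c = map (c *_)

_*P_ : Poly → Poly → Poly
[]       *P q = []
(a ∷ as) *P q = scale a q +P (0 ∷ (as *P q))

compose : Poly → Poly → Poly
compose []       q = []
compose (a ∷ as) q = (a ∷ []) +P (q *P compose as q)

Di : ∀ {n} → Graph n → Poly
Di {n} G = map (di G) (upTo (suc n))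

-- Write GF K = Σ_{T ⊆ V(K)} [T independent dominating] x^|T| for the generating
-- series of a graph K (a series ℕ → ℕ); its coefficients are those of Di K.
-- A subset of V(G[H]) = V(G) × V(H) is a vector F of blocks F_a ⊆ V(H), and the
-- structure theorem says: ⋃ₐ {a} × F_a is independent dominating in G[H] iff
-- its support S = {a | F_a ≠ ∅} is independent dominating in G and every
-- nonempty block is independent dominating in H.  Summing over S first,
--   GF (G[H]) = Σ_S [S i.d. in G] Π_a (Σ_X weight (a ∈ S) X) = Σ_S [S i.d. in G] (GF H)^|S|,
-- because the blocks over a ∈ S contribute GF H and the others only ∅, i.e. 1.
-- On the other side, Horner evaluation of compose gives Σ_j d_i(G,j) (GF H)^j,
-- the same sum grouped by |S|.
module Submission where

open import Defs
open import Data.Nat using (ℕ; zero; suc; _+_; _*_; _≤_; _<_; _≥_; s≤s; z≤n)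
import Data.Nat as ℕ
open import Data.Nat.Properties
  using (+-identityʳ; +-assoc; *-zeroʳ; *-identityʳ; *-distribʳ-+; *-distribˡ-+;
         +-commutativeSemigroup; *-commutativeSemigroup; <⇒≱)
open import Algebra.Properties.CommutativeSemigroup +-commutativeSemigroup
  using (interchange)
open import Algebra.Properties.CommutativeSemigroup *-commutativeSemigroup
  using (x∙yz≈y∙xz)
open import Data.Bool using (Bool; true; false; T; _∧_; _∨_)
import Data.Bool as Bool
open import Data.Unit using (tt)
open import Data.Product using (_×_; _,_; proj₁; proj₂; ∃₂)
open import Data.Sum using (_⊎_; inj₁; inj₂; [_,_])
open import Data.List using (List; []; _∷_; _++_; map; concat; concatMap; applyUpTo; upTo; length; filter)
open import Data.List.Properties using (map-applyUpTo)
open import Data.Vec using (Vec; []; _∷_; lookup; here; there)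
import Data.Vec as Vec
open import Data.Vec.Properties using (≡-dec; lookup-concat; []=⇒lookup; lookup⇒[]=)
open import Data.Vec.Relation.Binary.Pointwise.Inductive as Pointwise using (Pointwise; []; _∷_)
open import Data.Fin using (Fin; zero; suc; combine)
import Data.Fin as Fin
open import Data.Fin.Properties using (remQuot-combine; combine-surjective)
open import Data.Fin.Subset using (Subset; ∣_∣; _∈_; _∉_; Nonempty) renaming (⊥ to ∅)
open import Data.Fin.Subset.Properties using (∣p∣≤n; _∈?_; nonempty?; ∉⊥; Empty-unique; ∣⊥∣≡0)
open import Function using (_⇔_; mk⇔; Equivalence)
open Equivalence using (to; from)
open import Function.Properties.Equivalence using () renaming (trans to ⇔-trans)
open import Relation.Binary using (DecidableEquality)
open import Relation.Binary.PropositionalEquality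
  using (_≡_; _≢_; refl; sym; trans; cong; cong₂; subst; _≗_; module ≡-Reasoning)
open import Relation.Nullary using (Dec; yes; no; does; contradiction; ¬_)
open import Relation.Nullary.Decidable using (_×-dec_; dec-true; dec-false; does-⇔)

private variable
  A B : Set

Series : Set
Series = ℕ → ℕ

0ₛ : Series
0ₛ _ = 0

infixl 6 _⊕_
infixl 7 _⊛_ _⊙_
infixr 8 ⟪_⟫_

_⊕_ : Series → Series → Series
(f ⊕ g) k = f k + g k

_⊙_ : ℕ → Series → Series
(c ⊙ f) k = c * f k

shift : Series → Series
shift f k = f (suc k)

-- Cauchy product, written in the recursive shape of _*P_:
-- f · g = f₀ g + x · (shift f) g.
_⊛_ : Series → Series → Series
(f ⊛ g) zero    = f 0 * g 0
(f ⊛ g) (suc k) = f 0 * g (suc k) + (shift f ⊛ g) k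

X^ : ℕ → Series
X^ zero    zero    = 1
X^ zero    (suc k) = 0
X^ (suc a) zero    = 0
X^ (suc a) (suc k) = X^ a k

1ₛ : Series
1ₛ = X^ 0

pow : Series → ℕ → Series
pow f zero    = 1ₛ
pow f (suc j) = f ⊛ pow f j

⟪_⟫_ : Bool → Series → Series
⟪ true  ⟫ f = f
⟪ false ⟫ f = 0ₛ

⊛-congˡ : ∀ {f f′} g → f ≗ f′ → f ⊛ g ≗ f′ ⊛ g
⊛-congˡ g e zero    = cong (_* g 0) (e 0)
⊛-congˡ g e (suc k) = cong₂ _+_ (cong (_* g (suc k)) (e 0)) (⊛-congˡ g (λ i → e (suc i)) k)

⊛-congʳ : ∀ f {g g′} → g ≗ g′ → f ⊛ g ≗ f ⊛ g′
⊛-congʳ f e zero    = cong (f 0 *_) (e 0)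
⊛-congʳ f e (suc k) = cong₂ _+_ (cong (f 0 *_) (e (suc k))) (⊛-congʳ (shift f) e k)

⊛-zeroˡ : ∀ {f} g → f ≗ 0ₛ → f ⊛ g ≗ 0ₛ
⊛-zeroˡ g e zero    rewrite e 0 = refl
⊛-zeroˡ g e (suc k) rewrite e 0 = ⊛-zeroˡ g (λ i → e (suc i)) k

⊛-zeroʳ : ∀ f → f ⊛ 0ₛ ≗ 0ₛ
⊛-zeroʳ f zero    = *-zeroʳ (f 0)
⊛-zeroʳ f (suc k) rewrite *-zeroʳ (f 0) = ⊛-zeroʳ (shift f) k

⊛-identityˡ : ∀ g → 1ₛ ⊛ g ≗ g
⊛-identityˡ g zero    = +-identityʳ (g 0)
⊛-identityˡ g (suc k) =
  trans (cong₂ _+_ (+-identityʳ (g (suc k))) (⊛-zeroˡ g (λ _ → refl) k)) (+-identityʳ _)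

X^-⊛ : ∀ a b → X^ a ⊛ X^ b ≗ X^ (a + b)
X^-⊛ zero    b         = ⊛-identityˡ (X^ b)
X^-⊛ (suc a) b zero    = refl
X^-⊛ (suc a) b (suc k) = X^-⊛ a b k

⊛-distribʳ : ∀ f f′ g → (f ⊕ f′) ⊛ g ≗ f ⊛ g ⊕ f′ ⊛ g
⊛-distribʳ f f′ g zero    = *-distribʳ-+ (g 0) (f 0) (f′ 0)
⊛-distribʳ f f′ g (suc k) =
  trans (cong₂ _+_ (*-distribʳ-+ (g (suc k)) (f 0) (f′ 0)) (⊛-distribʳ (shift f) (shift f′) g k))
        (interchange (f 0 * g (suc k)) (f′ 0 * g (suc k)) ((shift f ⊛ g) k) ((shift f′ ⊛ g) k))

⊛-distribˡ : ∀ f g g′ → f ⊛ (g ⊕ g′) ≗ f ⊛ g ⊕ f ⊛ g′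
⊛-distribˡ f g g′ zero    = *-distribˡ-+ (f 0) (g 0) (g′ 0)
⊛-distribˡ f g g′ (suc k) =
  trans (cong₂ _+_ (*-distribˡ-+ (f 0) (g (suc k)) (g′ (suc k))) (⊛-distribˡ (shift f) g g′ k))
        (interchange (f 0 * g (suc k)) (f 0 * g′ (suc k)) ((shift f ⊛ g) k) ((shift f ⊛ g′) k))

⊛-⊙ʳ : ∀ c f g → f ⊛ (c ⊙ g) ≗ c ⊙ (f ⊛ g)
⊛-⊙ʳ c f g zero    = x∙yz≈y∙xz (f 0) c (g 0)
⊛-⊙ʳ c f g (suc k) =
  trans (cong₂ _+_ (x∙yz≈y∙xz (f 0) c (g (suc k))) (⊛-⊙ʳ c (shift f) g k))
        (sym (*-distribˡ-+ c _ _))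

⟪⟫-cong : ∀ b {f f′} → f ≗ f′ → ⟪ b ⟫ f ≗ ⟪ b ⟫ f′
⟪⟫-cong true  e k = e k
⟪⟫-cong false e k = refl

⟪⟫-∧ : ∀ b c f → ⟪ b ⟫ ⟪ c ⟫ f ≗ ⟪ b ∧ c ⟫ f
⟪⟫-∧ true  c f k = refl
⟪⟫-∧ false c f k = refl

⊛-⟪⟫ˡ : ∀ b f g → (⟪ b ⟫ f) ⊛ g ≗ ⟪ b ⟫ (f ⊛ g)
⊛-⟪⟫ˡ true  f g k = refl
⊛-⟪⟫ˡ false f g k = ⊛-zeroˡ g (λ _ → refl) k

⊛-⟪⟫ʳ : ∀ b f g → f ⊛ (⟪ b ⟫ g) ≗ ⟪ b ⟫ (f ⊛ g)
⊛-⟪⟫ʳ true  f g k = refl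
⊛-⟪⟫ʳ false f g k = ⊛-zeroʳ f k

ΣL : List A → (A → Series) → Series
ΣL []       F = 0ₛ
ΣL (x ∷ xs) F = F x ⊕ ΣL xs F

ΣL-cong : ∀ (xs : List A) {F F′} → (∀ x → F x ≗ F′ x) → ΣL xs F ≗ ΣL xs F′
ΣL-cong []       e k = refl
ΣL-cong (x ∷ xs) e k = cong₂ _+_ (e x k) (ΣL-cong xs e k)

ΣL-vanishes : ∀ (xs : List A) {F} k → (∀ x → F x k ≡ 0) → ΣL xs F k ≡ 0
ΣL-vanishes []       k e = refl
ΣL-vanishes (x ∷ xs) k e = cong₂ _+_ (e x) (ΣL-vanishes xs k e)

ΣL-zero : ∀ (xs : List A) {F} → (∀ x → F x ≗ 0ₛ) → ΣL xs F ≗ 0ₛ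
ΣL-zero xs e k = ΣL-vanishes xs k (λ x → e x k)

ΣL-++ : ∀ (xs ys : List A) F → ΣL (xs ++ ys) F ≗ ΣL xs F ⊕ ΣL ys F
ΣL-++ []       ys F k = refl
ΣL-++ (x ∷ xs) ys F k =
  trans (cong (F x k +_) (ΣL-++ xs ys F k)) (sym (+-assoc (F x k) (ΣL xs F k) (ΣL ys F k)))

ΣL-map : ∀ (g : B → A) (xs : List B) F → ΣL (map g xs) F ≗ ΣL xs (λ x → F (g x))
ΣL-map g []       F k = refl
ΣL-map g (x ∷ xs) F k = cong (F (g x) k +_) (ΣL-map g xs F k)

ΣL-concat : ∀ (xss : List (List A)) F → ΣL (concat xss) F ≗ ΣL xss (λ xs → ΣL xs F)
ΣL-concat []         F k = refl
ΣL-concat (xs ∷ xss) F k = trans (ΣL-++ xs (concat xss) F k) (cong (ΣL xs F k +_) (ΣL-concat xss F k))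

ΣL-⊕ : ∀ (xs : List A) F F′ → ΣL xs (λ x → F x ⊕ F′ x) ≗ ΣL xs F ⊕ ΣL xs F′
ΣL-⊕ []       F F′ k = refl
ΣL-⊕ (x ∷ xs) F F′ k =
  trans (cong (F x k + F′ x k +_) (ΣL-⊕ xs F F′ k))
        (interchange (F x k) (F′ x k) (ΣL xs F k) (ΣL xs F′ k))

ΣL-swap : ∀ (xs : List A) (ys : List B) (F : A → B → Series) →
          ΣL xs (λ x → ΣL ys (F x)) ≗ ΣL ys (λ y → ΣL xs (λ x → F x y))
ΣL-swap []       ys F k = sym (ΣL-zero ys (λ _ _ → refl) k)
ΣL-swap (x ∷ xs) ys F k =
  trans (cong (ΣL ys (F x) k +_) (ΣL-swap xs ys F k))
        (sym (ΣL-⊕ ys (F x) (λ y → ΣL xs (λ x′ → F x′ y)) k))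

⊛-ΣLˡ : ∀ (xs : List A) F g → g ⊛ ΣL xs F ≗ ΣL xs (λ x → g ⊛ F x)
⊛-ΣLˡ []       F g k = ⊛-zeroʳ g k
⊛-ΣLˡ (x ∷ xs) F g k =
  trans (⊛-distribˡ g (F x) (ΣL xs F) k) (cong ((g ⊛ F x) k +_) (⊛-ΣLˡ xs F g k))

⊛-ΣLʳ : ∀ (xs : List A) F g → ΣL xs F ⊛ g ≗ ΣL xs (λ x → F x ⊛ g)
⊛-ΣLʳ []       F g k = ⊛-zeroˡ g (λ _ → refl) k
⊛-ΣLʳ (x ∷ xs) F g k =
  trans (⊛-distribʳ (F x) (ΣL xs F) g k) (cong ((F x ⊛ g) k +_) (⊛-ΣLʳ xs F g k))

⟪⟫-ΣL : ∀ (xs : List A) b F → ⟪ b ⟫ ΣL xs F ≗ ΣL xs (λ x → ⟪ b ⟫ F x)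
⟪⟫-ΣL xs true  F k = refl
⟪⟫-ΣL xs false F k = sym (ΣL-zero xs (λ _ _ → refl) k)

ΣL-applyUpTo : ∀ (g : ℕ → A) N F → ΣL (applyUpTo g N) F ≗ ΣL (upTo N) (λ j → F (g j))
ΣL-applyUpTo g N F k =
  trans (cong (λ xs → ΣL xs F k) (sym (map-applyUpTo (λ j → j) g N))) (ΣL-map g (upTo N) F k)

ΣL-upTo-select : ∀ N c (P : ℕ → Series) → c < N → ΣL (upTo N) (λ j → ⟪ does (c ℕ.≟ j) ⟫ P j) ≗ P c
ΣL-upTo-select (suc N) zero P _ k =
  trans (cong (P 0 k +_) (trans (ΣL-applyUpTo suc N _ k) (ΣL-vanishes (upTo N) k (λ _ → refl))))
        (+-identityʳ (P 0 k))
ΣL-upTo-select (suc N) (suc c) P (s≤s c<N) k =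
  trans (ΣL-applyUpTo suc N _ k) (ΣL-upTo-select N c (λ j → P (suc j)) c<N k)

length-filter : ∀ {Pr : A → Set} (D : ∀ x → Dec (Pr x)) (xs : List A) (P : Series) →
                length (filter D xs) ⊙ P ≗ ΣL xs (λ x → ⟪ does (D x) ⟫ P)
length-filter D []       P k = refl
length-filter D (x ∷ xs) P k with does (D x)
... | true  = cong (P k +_) (length-filter D xs P k)
... | false = length-filter D xs P k

X^-diag : ∀ a → X^ a a ≡ 1
X^-diag zero    = refl
X^-diag (suc a) = X^-diag a

X^-off : ∀ a k → a ≢ k → X^ a k ≡ 0
X^-off zero    zero    a≢k = contradiction refl a≢k
X^-off zero    (suc k) _   = refl
X^-off (suc a) zero    _   = refl
X^-off (suc a) (suc k) a≢k = X^-off a k (λ e → a≢k (cong suc e))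

-- The number of hits of size k is the k-th coefficient of the size-generating series.
-- (The size test is kept abstract in the auxiliary form so that 'with' can inspect it.)
length-filter-size : ∀ {Pr : A → Set} (D : ∀ x → Dec (Pr x)) (size : A → ℕ) (xs : List A) k →
  length (filter (λ x → D x ×-dec (size x ℕ.≟ k)) xs) ≡ ΣL xs (λ x → ⟪ does (D x) ⟫ X^ (size x)) k
length-filter-size {A = A} D size xs k = go (λ x → size x ℕ.≟ k) xs
  where
  go : (E : ∀ x → Dec (size x ≡ k)) (xs : List A) →
       length (filter (λ x → D x ×-dec E x) xs) ≡ ΣL xs (λ x → ⟪ does (D x) ⟫ X^ (size x)) k
  go E []       = refl
  go E (x ∷ xs) with D x | E x
  ... | yes _ | yes s≡k =
    cong₂ _+_ (sym (trans (cong (X^ (size x)) (sym s≡k)) (X^-diag (size x)))) (go E xs)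
  ... | yes _ | no  s≢k = trans (go E xs) (cong (_+ _) (sym (X^-off (size x) k s≢k)))
  ... | no  _ | _       = go E xs

coeff-+P : ∀ p q → coeff (p +P q) ≗ coeff p ⊕ coeff q
coeff-+P []       q        k       = refl
coeff-+P (a ∷ as) []       k       = sym (+-identityʳ _)
coeff-+P (a ∷ as) (b ∷ bs) zero    = refl
coeff-+P (a ∷ as) (b ∷ bs) (suc k) = coeff-+P as bs k

coeff-scale : ∀ c p → coeff (scale c p) ≗ c ⊙ coeff p
coeff-scale c []      k       = sym (*-zeroʳ c)
coeff-scale c (a ∷ p) zero    = refl
coeff-scale c (a ∷ p) (suc k) = coeff-scale c p k

coeff-*P : ∀ p q → coeff (p *P q) ≗ coeff p ⊛ coeff q
coeff-*P []       q k       = sym (⊛-zeroˡ (coeff q) (λ _ → refl) k)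
coeff-*P (a ∷ as) q zero    =
  trans (coeff-+P (scale a q) (0 ∷ (as *P q)) zero) (trans (+-identityʳ _) (coeff-scale a q zero))
coeff-*P (a ∷ as) q (suc k) =
  trans (coeff-+P (scale a q) (0 ∷ (as *P q)) (suc k))
        (cong₂ _+_ (coeff-scale a q (suc k)) (coeff-*P as q k))

coeff-constant : ∀ a → coeff (a ∷ []) ≗ a ⊙ 1ₛ
coeff-constant a zero    = sym (*-identityʳ a)
coeff-constant a (suc k) = sym (*-zeroʳ a)

coeff-compose : ∀ f N q →
  coeff (compose (applyUpTo f N) q) ≗ ΣL (upTo N) (λ j → f j ⊙ pow (coeff q) j)
coeff-compose f zero    q k = refl
coeff-compose f (suc N) q k = begin
  coeff (compose (applyUpTo f (suc N)) q) k
    ≡⟨ coeff-+P (f 0 ∷ []) (q *P compose (applyUpTo (λ j → f (suc j)) N) q) k ⟩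
  coeff (f 0 ∷ []) k + coeff (q *P compose (applyUpTo (λ j → f (suc j)) N) q) k
    ≡⟨ cong₂ _+_ (coeff-constant (f 0) k)
                 (trans (coeff-*P q _ k) (⊛-congʳ Q (coeff-compose (λ j → f (suc j)) N q) k)) ⟩
  (f 0 ⊙ 1ₛ) k + (Q ⊛ ΣL (upTo N) (λ j → f (suc j) ⊙ pow Q j)) k
    ≡⟨ cong ((f 0 ⊙ 1ₛ) k +_)
            (trans (⊛-ΣLˡ (upTo N) _ Q k)
                   (ΣL-cong (upTo N) (λ j → ⊛-⊙ʳ (f (suc j)) Q (pow Q j)) k)) ⟩
  (f 0 ⊙ 1ₛ) k + ΣL (upTo N) (λ j → f (suc j) ⊙ pow Q (suc j)) k
    ≡⟨ cong ((f 0 ⊙ 1ₛ) k +_) (sym (ΣL-applyUpTo suc N (λ j → f j ⊙ pow Q j) k)) ⟩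
  ΣL (upTo (suc N)) (λ j → f j ⊙ pow Q j) k
    ∎
  where
  open ≡-Reasoning
  Q : Series
  Q = coeff q

coeff-applyUpTo : ∀ f M → (∀ k → M ≤ k → f k ≡ 0) → coeff (applyUpTo f M) ≗ f
coeff-applyUpTo f zero    vanish k       = sym (vanish k z≤n)
coeff-applyUpTo f (suc M) vanish zero    = refl
coeff-applyUpTo f (suc M) vanish (suc k) =
  coeff-applyUpTo (λ j → f (suc j)) M (λ j M≤j → vanish (suc j) (s≤s M≤j)) k

pow-cong : ∀ {f f′} j → f ≗ f′ → pow f j ≗ pow f′ j
pow-cong         zero    e k = refl
pow-cong {f′ = f′} (suc j) e k = trans (⊛-congˡ _ e k) (⊛-congʳ f′ (pow-cong j e) k)

isIDS : ∀ {N} → Graph N → Subset N → Bool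
isIDS K T = does (isIndepDom? K T)

GF : ∀ {N} → Graph N → Series
GF {N} K = ΣL (allSubsets N) (λ T → ⟪ isIDS K T ⟫ X^ ∣ T ∣)

di≡GF : ∀ {N} (K : Graph N) k → di K k ≡ GF K k
di≡GF {N} K = length-filter-size (isIndepDom? K) ∣_∣ (allSubsets N)

GF-vanishes : ∀ {N} (K : Graph N) k → N < k → GF K k ≡ 0
GF-vanishes {N} K k N<k = ΣL-vanishes (allSubsets N) k (λ T → summand (isIDS K T) T)
  where
  summand : ∀ b T → (⟪ b ⟫ X^ ∣ T ∣) k ≡ 0
  summand true  T = X^-off ∣ T ∣ k (λ |T|≡k → <⇒≱ N<k (subst (_≤ N) |T|≡k (∣p∣≤n T)))
  summand false T = refl

coeff-Di : ∀ {N} (K : Graph N) → coeff (Di K) ≗ GF K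
coeff-Di {N} K k = begin
  coeff (map (di K) (upTo (suc N))) k   ≡⟨ cong (λ p → coeff p k) (map-applyUpTo (λ j → j) (di K) (suc N)) ⟩
  coeff (applyUpTo (di K) (suc N)) k    ≡⟨ coeff-applyUpTo (di K) (suc N) vanish k ⟩
  di K k                                ≡⟨ di≡GF K k ⟩
  GF K k                                ∎
  where
  open ≡-Reasoning
  vanish : ∀ k → suc N ≤ k → di K k ≡ 0
  vanish k N<k = trans (di≡GF K k) (GF-vanishes K k N<k)

coeff-compose-Di : ∀ {m n} (G : Graph m) (H : Graph n) →
  coeff (compose (Di G) (Di H)) ≗ ΣL (allSubsets m) (λ S → ⟪ isIDS G S ⟫ pow (GF H) ∣ S ∣)
coeff-compose-Di {m} G H k = begin
  coeff (compose (map (di G) (upTo (suc m))) (Di H)) k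
    ≡⟨ cong (λ p → coeff (compose p (Di H)) k) (map-applyUpTo (λ j → j) (di G) (suc m)) ⟩
  coeff (compose (applyUpTo (di G) (suc m)) (Di H)) k
    ≡⟨ coeff-compose (di G) (suc m) (Di H) k ⟩
  ΣL (upTo (suc m)) (λ j → di G j ⊙ pow (coeff (Di H)) j) k
    ≡⟨ ΣL-cong (upTo (suc m)) (λ j k → cong (di G j *_) (pow-cong j (coeff-Di H) k)) k ⟩
  ΣL (upTo (suc m)) (λ j → di G j ⊙ pow (GF H) j) k
    ≡⟨ ΣL-cong (upTo (suc m)) (λ j → length-filter (λ S → isIndepDom? G S ×-dec (∣ S ∣ ℕ.≟ j))
                                                    (allSubsets m) (pow (GF H) j)) k ⟩
  ΣL (upTo (suc m)) (λ j → ΣL (allSubsets m) (λ S → ⟪ isIDS G S ∧ does (∣ S ∣ ℕ.≟ j) ⟫ pow (GF H) j)) k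
    ≡⟨ ΣL-swap (upTo (suc m)) (allSubsets m) _ k ⟩
  ΣL (allSubsets m) (λ S → ΣL (upTo (suc m)) (λ j → ⟪ isIDS G S ∧ does (∣ S ∣ ℕ.≟ j) ⟫ pow (GF H) j)) k
    ≡⟨ ΣL-cong (allSubsets m) (λ S → selectSize S (isIDS G S)) k ⟩
  ΣL (allSubsets m) (λ S → ⟪ isIDS G S ⟫ pow (GF H) ∣ S ∣) k
    ∎
  where
  open ≡-Reasoning
  selectSize : ∀ S b → ΣL (upTo (suc m)) (λ j → ⟪ b ∧ does (∣ S ∣ ℕ.≟ j) ⟫ pow (GF H) j)
                       ≗ ⟪ b ⟫ pow (GF H) ∣ S ∣
  selectSize S b k = begin
    ΣL (upTo (suc m)) (λ j → ⟪ b ∧ does (∣ S ∣ ℕ.≟ j) ⟫ pow (GF H) j) k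
      ≡⟨ ΣL-cong (upTo (suc m)) (λ j → λ k → sym (⟪⟫-∧ b _ _ k)) k ⟩
    ΣL (upTo (suc m)) (λ j → ⟪ b ⟫ ⟪ does (∣ S ∣ ℕ.≟ j) ⟫ pow (GF H) j) k
      ≡⟨ sym (⟪⟫-ΣL (upTo (suc m)) b _ k) ⟩
    (⟪ b ⟫ ΣL (upTo (suc m)) (λ j → ⟪ does (∣ S ∣ ℕ.≟ j) ⟫ pow (GF H) j)) k
      ≡⟨ ⟪⟫-cong b (ΣL-upTo-select (suc m) ∣ S ∣ (pow (GF H)) (s≤s (∣p∣≤n S))) k ⟩
    (⟪ b ⟫ pow (GF H) ∣ S ∣) k
      ∎

_≟ₛ_ : ∀ {n} → DecidableEquality (Subset n)
_≟ₛ_ = ≡-dec Bool._≟_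

ΣL-allSubsets-suc : ∀ n (F : Subset (suc n) → Series) →
  ΣL (allSubsets (suc n)) F ≗ ΣL (allSubsets n) (λ X → F (true ∷ X)) ⊕ ΣL (allSubsets n) (λ X → F (false ∷ X))
ΣL-allSubsets-suc n F k =
  trans (ΣL-++ (map (true ∷_) (allSubsets n)) (map (false ∷_) (allSubsets n)) F k)
        (cong₂ _+_ (ΣL-map (true ∷_) (allSubsets n) F k) (ΣL-map (false ∷_) (allSubsets n) F k))

-- Each subset occurs exactly once: the guard [X = X₀] picks out the term X₀.
ΣL-allSubsets-select : ∀ n (X₀ : Subset n) (f : Subset n → Series) →
  ΣL (allSubsets n) (λ X → ⟪ does (X ≟ₛ X₀) ⟫ f X) ≗ f X₀
ΣL-allSubsets-select zero    []       f k = +-identityʳ _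
ΣL-allSubsets-select (suc n) (b ∷ X₀) f k =
  trans (ΣL-allSubsets-suc n _ k) (select b)
  where
  select : ∀ b → ΣL (allSubsets n) (λ X → ⟪ does (true Bool.≟ b) ∧ does (X ≟ₛ X₀) ⟫ f (true ∷ X)) k
               + ΣL (allSubsets n) (λ X → ⟪ does (false Bool.≟ b) ∧ does (X ≟ₛ X₀) ⟫ f (false ∷ X)) k
               ≡ f (b ∷ X₀) k
  select true  = trans (cong₂ _+_ (ΣL-allSubsets-select n X₀ (λ X → f (true ∷ X)) k)
                                  (ΣL-vanishes (allSubsets n) k (λ _ → refl)))
                       (+-identityʳ _)
  select false = trans (cong (_+ ΣL (allSubsets n) (λ X → ⟪ does (X ≟ₛ X₀) ⟫ f (false ∷ X)) k)
                             (ΣL-vanishes (allSubsets n) k (λ _ → refl)))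
                       (ΣL-allSubsets-select n X₀ (λ X → f (false ∷ X)) k)

ΣL-allSubsets-++ : ∀ a b (Φ : Subset (a + b) → Series) →
  ΣL (allSubsets (a + b)) Φ ≗ ΣL (allSubsets a) (λ A → ΣL (allSubsets b) (λ B → Φ (A Vec.++ B)))
ΣL-allSubsets-++ zero    b Φ k = sym (+-identityʳ _)
ΣL-allSubsets-++ (suc a) b Φ k =
  trans (ΣL-allSubsets-suc (a + b) Φ k)
  (trans (cong₂ _+_ (ΣL-allSubsets-++ a b (λ X → Φ (true ∷ X)) k)
                    (ΣL-allSubsets-++ a b (λ X → Φ (false ∷ X)) k))
         (sym (ΣL-allSubsets-suc a _ k)))

vectors : List A → (k : ℕ) → List (Vec A k)
vectors xs zero    = [] ∷ []
vectors xs (suc k) = concatMap (λ x → map (x ∷_) (vectors xs k)) xs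

ΣL-vectors-suc : ∀ (xs : List A) k F →
  ΣL (vectors xs (suc k)) F ≗ ΣL xs (λ x → ΣL (vectors xs k) (λ v → F (x ∷ v)))
ΣL-vectors-suc xs k F i =
  trans (ΣL-concat (map (λ x → map (x ∷_) (vectors xs k)) xs) F i)
  (trans (ΣL-map (λ x → map (x ∷_) (vectors xs k)) xs _ i)
         (ΣL-cong xs (λ x → ΣL-map (x ∷_) (vectors xs k) F) i))

ΣL-blocks : ∀ m n (Φ : Subset (m * n) → Series) →
  ΣL (allSubsets (m * n)) Φ ≗ ΣL (vectors (allSubsets n) m) (λ F → Φ (Vec.concat F))
ΣL-blocks zero    n Φ k = refl
ΣL-blocks (suc m) n Φ k =
  trans (ΣL-allSubsets-++ n (m * n) Φ k)
  (trans (ΣL-cong (allSubsets n) (λ X → ΣL-blocks m n (λ T → Φ (X Vec.++ T))) k)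
         (sym (ΣL-vectors-suc (allSubsets n) m _ k)))

T-does : ∀ {P : Set} (d : Dec P) → T (does d) ⇔ P
T-does (yes p) = mk⇔ (λ _ → p) (λ _ → tt)
T-does (no ¬p) = mk⇔ (λ ()) ¬p

-- The shape of the adjacency test of lexProd.
T-∨-does-∧ : ∀ u {P : Set} (d : Dec P) w → T (u ∨ (does d ∧ w)) ⇔ (T u ⊎ (P × T w))
T-∨-does-∧ true  d       w = mk⇔ inj₁ (λ _ → tt)
T-∨-does-∧ false (yes p) w = mk⇔ (λ t → inj₂ (p , t)) [ (λ ()) , proj₂ ]
T-∨-does-∧ false (no ¬p) w = mk⇔ (λ ()) [ (λ ()) , (λ (p , _) → ¬p p) ]

zero∈⇔ : ∀ {k} b (p : Subset k) → zero ∈ (b ∷ p) ⇔ T b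
zero∈⇔ true  p = mk⇔ (λ _ → tt) (λ _ → here)
zero∈⇔ false p = mk⇔ (λ ()) (λ ())

∣++∣ : ∀ {a b} (X : Subset a) (Y : Subset b) → ∣ X Vec.++ Y ∣ ≡ ∣ X ∣ + ∣ Y ∣
∣++∣ []          Y = refl
∣++∣ (true  ∷ X) Y = cong suc (∣++∣ X Y)
∣++∣ (false ∷ X) Y = ∣++∣ X Y

IDS-nonempty : ∀ {n} (K : Graph n) {X : Subset n} → Fin n → IsIndepDom K X → Nonempty X
IDS-nonempty K {X} y₀ (_ , dom) with y₀ ∈? X
... | yes y₀∈X = y₀ , y₀∈X
... | no  y₀∉X = let (u , u∈X , _) = dom y₀ y₀∉X in u , u∈X

module LexProduct {m n : ℕ} (G : Graph m) (H : Graph n) where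

  L : Graph (m * n)
  L = lexProd G H

  supp : ∀ {k} → Vec (Subset n) k → Subset k
  supp = Vec.map (λ X → does (nonempty? X))

  ∈-supp : ∀ {k} (F : Vec (Subset n) k) a → a ∈ supp F ⇔ Nonempty (lookup F a)
  ∈-supp (X ∷ F) zero    = ⇔-trans (zero∈⇔ _ (supp F)) (T-does (nonempty? X))
  ∈-supp (X ∷ F) (suc a) =
    mk⇔ (λ { (there a∈) → to (∈-supp F a) a∈ }) (λ ne → there (from (∈-supp F a) ne))

  Block : Bool → Subset n → Set
  Block true  X = IsIndepDom H X
  Block false X = X ≡ ∅

  block? : ∀ b X → Dec (Block b X)
  block? true  X = isIndepDom? H X
  block? false X = X ≟ₛ ∅

  Fits : ∀ {k} → Subset k → Vec (Subset n) k → Set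
  Fits = Pointwise Block

  fits? : ∀ {k} (S : Subset k) (F : Vec (Subset n) k) → Dec (Fits S F)
  fits? = Pointwise.decidable block?

  fits⇒supp : Fin n → ∀ {k} (S : Subset k) F → Fits S F → S ≡ supp F
  fits⇒supp y₀ []      []      []         = refl
  fits⇒supp y₀ (true  ∷ S) (X ∷ F) (ids ∷ fits) =
    cong₂ _∷_ (sym (dec-true (nonempty? X) (IDS-nonempty H y₀ ids))) (fits⇒supp y₀ S F fits)
  fits⇒supp y₀ (false ∷ S) (X ∷ F) (refl ∷ fits) =
    cong₂ _∷_ (sym (dec-false (nonempty? (∅ {n})) (λ (_ , x∈∅) → ∉⊥ x∈∅))) (fits⇒supp y₀ S F fits)

  fits-supp⇔ : ∀ {k} (F : Vec (Subset n) k) →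
    Fits (supp F) F ⇔ (∀ a → Nonempty (lookup F a) → IsIndepDom H (lookup F a))
  fits-supp⇔ []      = mk⇔ (λ _ ()) (λ _ → [])
  fits-supp⇔ (X ∷ F) = byHead (nonempty? X)
    where
    byHead : (d : Dec (Nonempty X)) → Pointwise Block (does d ∷ supp F) (X ∷ F) ⇔
             (∀ a → Nonempty (lookup (X ∷ F) a) → IsIndepDom H (lookup (X ∷ F) a))
    byHead (yes ne) = mk⇔ (λ { (ids ∷ _) zero _ → ids ; (_ ∷ fits) (suc a) → to (fits-supp⇔ F) fits a })
                          (λ h → h zero ne ∷ from (fits-supp⇔ F) (λ a → h (suc a)))
    byHead (no ¬ne) = mk⇔ (λ { (_ ∷ _) zero ne → contradiction ne ¬ne ; (_ ∷ fits) (suc a) → to (fits-supp⇔ F) fits a })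
                          (λ h → Empty-unique ¬ne ∷ from (fits-supp⇔ F) (λ a → h (suc a)))

  LexAdj : Fin m → Fin n → Fin m → Fin n → Set
  LexAdj a x b y = Adj G a b ⊎ (a ≡ b × Adj H x y)

  Adj-lexProd : ∀ a x b y → Adj L (combine a x) (combine b y) ⇔ LexAdj a x b y
  Adj-lexProd a x b y =
    subst (λ β → T β ⇔ LexAdj a x b y) (sym adj-combine) (T-∨-does-∧ (adj G a b) (a Fin.≟ b) (adj H x y))
    where
    lexTest : Fin m × Fin n → Fin m × Fin n → Bool
    lexTest r s = adj G (proj₁ r) (proj₁ s) ∨ (does (proj₁ r Fin.≟ proj₁ s) ∧ adj H (proj₂ r) (proj₂ s))
    adj-combine : adj L (combine a x) (combine b y) ≡ adj G a b ∨ (does (a Fin.≟ b) ∧ adj H x y)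
    adj-combine = cong₂ lexTest (remQuot-combine a x) (remQuot-combine b y)

  ∈-concat : ∀ (F : Vec (Subset n) m) a x → combine a x ∈ Vec.concat F ⇔ x ∈ lookup F a
  ∈-concat F a x =
    mk⇔ (λ a,x∈ → lookup⇒[]= x _ (trans (sym (lookup-concat F a x)) ([]=⇒lookup a,x∈)))
        (λ x∈ → lookup⇒[]= (combine a x) _ (trans (lookup-concat F a x) ([]=⇒lookup x∈)))

  BlockIndependent : Vec (Subset n) m → Set
  BlockIndependent F = ∀ a x b y → x ∈ lookup F a → y ∈ lookup F b → ¬ LexAdj a x b y

  BlockDominating : Vec (Subset n) m → Set
  BlockDominating F = ∀ b y → y ∉ lookup F b → ∃₂ λ a x → x ∈ lookup F a × LexAdj a x b y

  independent⇔ : ∀ F → IsIndependent L (Vec.concat F) ⇔ BlockIndependent F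
  independent⇔ F = mk⇔ ltr rtl
    where
    ltr : IsIndependent L (Vec.concat F) → BlockIndependent F
    ltr ind a x b y x∈ y∈ lex =
      ind _ _ (from (∈-concat F a x) x∈) (from (∈-concat F b y) y∈) (from (Adj-lexProd a x b y) lex)
    rtl : BlockIndependent F → IsIndependent L (Vec.concat F)
    rtl bind u v u∈ v∈ u~v with combine-surjective {m} {n} u | combine-surjective {m} {n} v
    ... | a , x , refl | b , y , refl =
      bind a x b y (to (∈-concat F a x) u∈) (to (∈-concat F b y) v∈) (to (Adj-lexProd a x b y) u~v)

  dominating⇔ : ∀ F → IsDominating L (Vec.concat F) ⇔ BlockDominating F
  dominating⇔ F = mk⇔ ltr rtl
    where
    ltr : IsDominating L (Vec.concat F) → BlockDominating F
    ltr dom b y y∉ with dom (combine b y) (λ b,y∈ → y∉ (to (∈-concat F b y) b,y∈))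
    ... | u , u∈ , u~ with combine-surjective {m} {n} u
    ... | a , x , refl = a , x , to (∈-concat F a x) u∈ , to (Adj-lexProd a x b y) u~
    rtl : BlockDominating F → IsDominating L (Vec.concat F)
    rtl bdom v v∉ with combine-surjective {m} {n} v
    ... | b , y , refl with bdom b y (λ y∈ → v∉ (from (∈-concat F b y) y∈))
    ... | a , x , x∈ , lex = combine a x , from (∈-concat F a x) x∈ , from (Adj-lexProd a x b y) lex

  independent-blocks : ∀ F →
    BlockIndependent F ⇔ (IsIndependent G (supp F) × (∀ a → IsIndependent H (lookup F a)))
  independent-blocks F = mk⇔ ltr rtl
    where
    ltr : BlockIndependent F → IsIndependent G (supp F) × (∀ a → IsIndependent H (lookup F a))
    ltr bind = indG , indH
      where
      indG : IsIndependent G (supp F)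
      indG a b a∈ b∈ a~b with to (∈-supp F a) a∈ | to (∈-supp F b) b∈
      ... | x , x∈ | y , y∈ = bind a x b y x∈ y∈ (inj₁ a~b)
      indH : ∀ a → IsIndependent H (lookup F a)
      indH a x y x∈ y∈ x~y = bind a x a y x∈ y∈ (inj₂ (refl , x~y))
    rtl : IsIndependent G (supp F) × (∀ a → IsIndependent H (lookup F a)) → BlockIndependent F
    rtl (indG , indH) a x b y x∈ y∈ (inj₁ a~b) =
      indG a b (from (∈-supp F a) (x , x∈)) (from (∈-supp F b) (y , y∈)) a~b
    rtl (indG , indH) a x b y x∈ y∈ (inj₂ (refl , x~y)) = indH a x y x∈ y∈ x~y

  -- Outside the support
  -- a vertex (b, y₀) can only be dominated through G; inside, a dominator through G
  -- would be adjacent to the whole nonempty block, so domination happens within H.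
  dominating-blocks⇒ : Fin n → ∀ F → BlockIndependent F → BlockDominating F →
    IsDominating G (supp F) × (∀ a → Nonempty (lookup F a) → IsDominating H (lookup F a))
  dominating-blocks⇒ y₀ F bind bdom = domG , domH
    where
    domG : IsDominating G (supp F)
    domG b b∉ with bdom b y₀ (λ y₀∈ → b∉ (from (∈-supp F b) (y₀ , y₀∈)))
    ... | a , x , x∈ , inj₁ a~b      = a , from (∈-supp F a) (x , x∈) , a~b
    ... | a , x , x∈ , inj₂ (refl , _) = contradiction (from (∈-supp F a) (x , x∈)) b∉
    domH : ∀ a → Nonempty (lookup F a) → IsDominating H (lookup F a)
    domH a (x₀ , x₀∈) y y∉ with bdom a y y∉
    ... | b , x , x∈ , inj₁ b~a          = contradiction (inj₁ b~a) (bind b x a x₀ x∈ x₀∈)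
    ... | b , x , x∈ , inj₂ (refl , x~y) = x , x∈ , x~y

  dominating-blocks⇐ : ∀ F → IsDominating G (supp F) →
    (∀ a → Nonempty (lookup F a) → IsDominating H (lookup F a)) → BlockDominating F
  dominating-blocks⇐ F domG domH b y y∉ with nonempty? (lookup F b)
  ... | yes ne =
    let (x , x∈ , x~y) = domH b ne y y∉ in b , x , x∈ , inj₂ (refl , x~y)
  ... | no ¬ne =
    let (a , a∈ , a~b) = domG b (λ b∈ → ¬ne (to (∈-supp F b) b∈))
        (x , x∈)       = to (∈-supp F a) a∈
    in  a , x , x∈ , inj₁ a~b

  IDS-lexProd⇔ : Fin n → ∀ F → IsIndepDom L (Vec.concat F) ⇔ (IsIndepDom G (supp F) × Fits (supp F) F)
  IDS-lexProd⇔ y₀ F = mk⇔ ltr rtl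
    where
    ltr : IsIndepDom L (Vec.concat F) → IsIndepDom G (supp F) × Fits (supp F) F
    ltr (ind , dom) =
      let bind           = to (independent⇔ F) ind
          (indG , indH)  = to (independent-blocks F) bind
          (domG , domH)  = dominating-blocks⇒ y₀ F bind (to (dominating⇔ F) dom)
      in  (indG , domG) , from (fits-supp⇔ F) (λ a ne → indH a , domH a ne)
    rtl : IsIndepDom G (supp F) × Fits (supp F) F → IsIndepDom L (Vec.concat F)
    rtl ((indG , domG) , fits) =
      from (independent⇔ F) (from (independent-blocks F) (indG , indH)) ,
      from (dominating⇔ F) (dominating-blocks⇐ F domG (λ a ne → proj₂ (blocksIDS a ne)))
      where
      blocksIDS = to (fits-supp⇔ F) fits
      indH : ∀ a → IsIndependent H (lookup F a)
      indH a x y x∈ = proj₁ (blocksIDS a (x , x∈)) x y x∈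

  decomposition⇔ : Fin n → ∀ S F →
    (IsIndepDom G S × Fits S F) ⇔ (S ≡ supp F × IsIndepDom L (Vec.concat F))
  decomposition⇔ y₀ S F = mk⇔ ltr rtl
    where
    ltr : IsIndepDom G S × Fits S F → S ≡ supp F × IsIndepDom L (Vec.concat F)
    ltr (ids , fits) with fits⇒supp y₀ S F fits
    ... | refl = refl , from (IDS-lexProd⇔ y₀ F) (ids , fits)
    rtl : S ≡ supp F × IsIndepDom L (Vec.concat F) → IsIndepDom G S × Fits S F
    rtl (refl , idsL) = to (IDS-lexProd⇔ y₀ F) idsL

  weight : Bool → Subset n → Series
  weight b X = ⟪ does (block? b X) ⟫ X^ ∣ X ∣

  blockWeight : ∀ {k} → Subset k → Vec (Subset n) k → Series
  blockWeight []      []      = 1ₛ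
  blockWeight (b ∷ S) (X ∷ F) = weight b X ⊛ blockWeight S F

  blockWeight-fits : ∀ {k} (S : Subset k) F →
    blockWeight S F ≗ ⟪ does (fits? S F) ⟫ X^ ∣ Vec.concat F ∣
  blockWeight-fits []      []      k = refl
  blockWeight-fits {suc j} (b ∷ S) (X ∷ F) k = begin
    (weight b X ⊛ blockWeight S F) k
      ≡⟨ ⊛-congʳ (weight b X) (blockWeight-fits S F) k ⟩
    (⟪ β ⟫ X^ ∣ X ∣ ⊛ ⟪ φ ⟫ X^ ∣ ⋃F ∣) k
      ≡⟨ ⊛-⟪⟫ˡ β (X^ ∣ X ∣) (⟪ φ ⟫ X^ ∣ ⋃F ∣) k ⟩
    (⟪ β ⟫ (X^ ∣ X ∣ ⊛ ⟪ φ ⟫ X^ ∣ ⋃F ∣)) k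
      ≡⟨ ⟪⟫-cong β (⊛-⟪⟫ʳ φ (X^ ∣ X ∣) (X^ ∣ ⋃F ∣)) k ⟩
    (⟪ β ⟫ ⟪ φ ⟫ (X^ ∣ X ∣ ⊛ X^ ∣ ⋃F ∣)) k
      ≡⟨ ⟪⟫-∧ β φ (X^ ∣ X ∣ ⊛ X^ ∣ ⋃F ∣) k ⟩
    (⟪ β ∧ φ ⟫ (X^ ∣ X ∣ ⊛ X^ ∣ ⋃F ∣)) k
      ≡⟨ ⟪⟫-cong (β ∧ φ) (X^-⊛ ∣ X ∣ ∣ ⋃F ∣) k ⟩
    (⟪ β ∧ φ ⟫ X^ (∣ X ∣ + ∣ ⋃F ∣)) k
      ≡⟨ cong (λ s → (⟪ β ∧ φ ⟫ X^ s) k) (sym (∣++∣ X ⋃F)) ⟩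
    (⟪ β ∧ φ ⟫ X^ ∣ X Vec.++ ⋃F ∣) k
      ∎
    where
    open ≡-Reasoning
    β φ : Bool
    β = does (block? b X)
    φ = does (fits? S F)
    ⋃F : Subset (j * n)
    ⋃F = Vec.concat F

  -- Outside the support only the empty block is allowed, contributing 1.
  ΣL-weight-false : ΣL (allSubsets n) (weight false) ≗ 1ₛ
  ΣL-weight-false k =
    trans (ΣL-allSubsets-select n ∅ (λ X → X^ ∣ X ∣) k) (cong (λ s → X^ s k) (∣⊥∣≡0 n))

  -- The sum of products over all block vectors factorises into Π_a Σ_X weight (S a) X,
  -- i.e. one factor GF H for each a ∈ S.
  ΣL-blockWeight : ∀ {k} (S : Subset k) →
    ΣL (vectors (allSubsets n) k) (blockWeight S) ≗ pow (GF H) ∣ S ∣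
  ΣL-blockWeight []      k = +-identityʳ _
  ΣL-blockWeight {suc j} (b ∷ S) k = begin
    ΣL (vectors (allSubsets n) (suc j)) (blockWeight (b ∷ S)) k
      ≡⟨ ΣL-vectors-suc (allSubsets n) j _ k ⟩
    ΣL (allSubsets n) (λ X → ΣL (vectors (allSubsets n) j) (λ F → weight b X ⊛ blockWeight S F)) k
      ≡⟨ ΣL-cong (allSubsets n) (λ X k → sym (⊛-ΣLˡ (vectors (allSubsets n) j) _ (weight b X) k)) k ⟩
    ΣL (allSubsets n) (λ X → weight b X ⊛ ΣL (vectors (allSubsets n) j) (blockWeight S)) k
      ≡⟨ sym (⊛-ΣLʳ (allSubsets n) (weight b) _ k) ⟩
    (ΣL (allSubsets n) (weight b) ⊛ ΣL (vectors (allSubsets n) j) (blockWeight S)) k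
      ≡⟨ ⊛-congʳ (ΣL (allSubsets n) (weight b)) (ΣL-blockWeight S) k ⟩
    (ΣL (allSubsets n) (weight b) ⊛ pow (GF H) ∣ S ∣) k
      ≡⟨ factor b ⟩
    pow (GF H) ∣ b ∷ S ∣ k
      ∎
    where
    open ≡-Reasoning
    factor : ∀ b → (ΣL (allSubsets n) (weight b) ⊛ pow (GF H) ∣ S ∣) k ≡ pow (GF H) ∣ b ∷ S ∣ k
    factor true  = refl
    factor false = trans (⊛-congˡ _ ΣL-weight-false k) (⊛-identityˡ _ k)

  -- Each i.d. set of G[H] is counted once, under its support S = supp F.
  split-by-support : Fin n → ∀ F →
    ⟪ isIDS L (Vec.concat F) ⟫ X^ ∣ Vec.concat F ∣ ≗ ΣL (allSubsets m) (λ S → ⟪ isIDS G S ⟫ blockWeight S F)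
  split-by-support y₀ F k = sym (begin
    ΣL (allSubsets m) (λ S → ⟪ isIDS G S ⟫ blockWeight S F) k
      ≡⟨ ΣL-cong (allSubsets m) (λ S k → trans (⟪⟫-cong (isIDS G S) (blockWeight-fits S F) k)
                                                (⟪⟫-∧ (isIDS G S) (does (fits? S F)) x^⋃F k)) k ⟩
    ΣL (allSubsets m) (λ S → ⟪ does (isIndepDom? G S ×-dec fits? S F) ⟫ x^⋃F) k
      ≡⟨ ΣL-cong (allSubsets m) (λ S k → cong (λ β → (⟪ β ⟫ x^⋃F) k)
           (does-⇔ (decomposition⇔ y₀ S F) (isIndepDom? G S ×-dec fits? S F)
                                           ((S ≟ₛ supp F) ×-dec isIndepDom? L ⋃F))) k ⟩
    ΣL (allSubsets m) (λ S → ⟪ does (S ≟ₛ supp F) ∧ isIDS L ⋃F ⟫ x^⋃F) k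
      ≡⟨ ΣL-cong (allSubsets m) (λ S k → sym (⟪⟫-∧ (does (S ≟ₛ supp F)) (isIDS L ⋃F) x^⋃F k)) k ⟩
    ΣL (allSubsets m) (λ S → ⟪ does (S ≟ₛ supp F) ⟫ ⟪ isIDS L ⋃F ⟫ x^⋃F) k
      ≡⟨ ΣL-allSubsets-select m (supp F) (λ _ → ⟪ isIDS L ⋃F ⟫ x^⋃F) k ⟩
    (⟪ isIDS L ⋃F ⟫ x^⋃F) k
      ∎)
    where
    open ≡-Reasoning
    ⋃F : Subset (m * n)
    ⋃F = Vec.concat F
    x^⋃F : Series
    x^⋃F = X^ ∣ ⋃F ∣

  GF-lexProd : Fin n → GF L ≗ ΣL (allSubsets m) (λ S → ⟪ isIDS G S ⟫ pow (GF H) ∣ S ∣)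
  GF-lexProd y₀ k = begin
    GF L k
      ≡⟨ ΣL-blocks m n (λ T → ⟪ isIDS L T ⟫ X^ ∣ T ∣) k ⟩
    ΣL blockVectors (λ F → ⟪ isIDS L (Vec.concat F) ⟫ X^ ∣ Vec.concat F ∣) k
      ≡⟨ ΣL-cong blockVectors (split-by-support y₀) k ⟩
    ΣL blockVectors (λ F → ΣL (allSubsets m) (λ S → ⟪ isIDS G S ⟫ blockWeight S F)) k
      ≡⟨ ΣL-swap blockVectors (allSubsets m) _ k ⟩
    ΣL (allSubsets m) (λ S → ΣL blockVectors (λ F → ⟪ isIDS G S ⟫ blockWeight S F)) k
      ≡⟨ ΣL-cong (allSubsets m) (λ S k → trans (sym (⟪⟫-ΣL blockVectors (isIDS G S) _ k))
                                                (⟪⟫-cong (isIDS G S) (ΣL-blockWeight S) k)) k ⟩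
    ΣL (allSubsets m) (λ S → ⟪ isIDS G S ⟫ pow (GF H) ∣ S ∣) k
      ∎
    where
    open ≡-Reasoning
    blockVectors : List (Vec (Subset n) m)
    blockVectors = vectors (allSubsets n) m

open LexProduct using (GF-lexProd)

-- The theorem.  The hypothesis n ≥ 1 provides a vertex of H (without one, the
-- empty set would be i.d. in H and the identity fails).
mainTheorem2 : ∀ {m n} (G : Graph m) (H : Graph n) → m ≥ 1 → n ≥ 1
    → IsSimple G → IsSimple H
    → ∀ k → coeff (Di (lexProd G H)) k ≡ coeff (compose (Di G) (Di H)) k
mainTheorem2 G H _ (s≤s z≤n) _ _ k = begin
  coeff (Di (lexProd G H)) k                                  ≡⟨ coeff-Di (lexProd G H) k ⟩
  GF (lexProd G H) k                                          ≡⟨ GF-lexProd G H zero k ⟩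
  ΣL (allSubsets _) (λ S → ⟪ isIDS G S ⟫ pow (GF H) ∣ S ∣) k  ≡⟨ coeff-compose-Di G H k ⟨
  coeff (compose (Di G) (Di H)) k                             ∎
  where open ≡-Reasoning
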